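{- Let $T$ be a complete theory with monster model $\mathcal M$, $\varphi(x,y)$ a formula and $\langle a_\eta\rangle_{\eta\in{}^{\omega>}2}$ a tree of parameters. (i) If $\langle\varphi(x,y),\langle a_\eta\rangle_{\eta\in{}^{\omega>}2}\rangle$ is an antichain tree, then there is no map $h:{}^{2\ge}2\to{}^{\omega>}2$ such that, with $b_\eta=a_{h(\eta)}$, the family $\langle\varphi(x,y),\langle b_\eta\rangle_{\eta\in{}^{2\ge}2}\rangle$ satisfies the conditions of $\mathrm{SOP}_2$ on ${}^{2\ge}2$ (i.e. $\{\varphi(x,b_{\eta\lceil i}):i\le2\}$ is consistent for each $\eta\in{}^22$, and $\{\varphi(x,b_\eta),\varphi(x,b_\nu)\}$ is inconsistent for all incomparable $\eta,\nu\in{}^{2\ge}2$). (ii) If $\langle\varphi(x,y),\langle a_\eta\rangle_{\eta\in{}^{\omega>}2}\rangle$ witnesses $\mathrm{SOP}_2$, then there is no map $h:{}^{2\ge}2\to{}^{\omega>}2$ such that, with $b_\eta=a_{h(\eta)}$, the family $\langle\varphi(x,y),\langle b_\eta\rangle_{\eta\in{}^{2\ge}2}\rangle$ is an antichain tree of height 2 (i.e. for all $X\subseteq{}^{2\ge}2$, $\{\varphi(x,b_\eta):\eta\in X\}$ is consistent iff $X$ is an antichain).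
   Context: ${}^{2\ge}2$ is the set of binary sequences of length at most 2; $\unlhd$ is the initial-segment order; an antichain is a set of pairwise $\unlhd$-incomparable elements. $\langle\varphi,\langle a_\eta\rangle_{\eta\in{}^{\omega>}2}\rangle$ is an antichain tree if for all $X\subseteq{}^{\omega>}2$, $\{\varphi(x,a_\eta):\eta\in X\}$ is consistent iff $X$ is an antichain. $\langle\varphi,\langle a_\eta\rangle_{\eta\in{}^{\omega>}2}\rangle$ witnesses $\mathrm{SOP}_2$ if every branch $\{\varphi(x,a_{\eta\lceil n}):n<\omega\}$ ($\eta\in{}^\omega2$) is consistent and $\{\varphi(x,a_\eta),\varphi(x,a_\nu)\}$ is inconsistent for all incomparable $\eta,\nu$. -}

module Defs where

open import Data.Bool using (Bool)
open import Data.Nat using (ℕ; zero; suc; _≤_)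
open import Data.List using (List; []; _∷_; _++_; length)
open import Data.Product using (Σ; ∃; _×_; _,_; proj₁)
open import Relation.Nullary using (¬_)
open import Relation.Binary.PropositionalEquality using (_≡_)
open import Function using (_∘_)

-- A "formula" φ(x,y) in the monster model M of a complete theory T, given
-- semantically: Xs = M^|x|, Ys = M^|y|, Sat c a  ⇔  M ⊨ φ(c,a).
record Formula : Set₁ where
  field
    Xs  : Set
    Ys  : Set
    Sat : Xs → Ys → Set
open Formula public

Seq : Set
Seq = List Bool

_⊴_ : Seq → Seq → Set
η ⊴ ν = ∃ λ ζ → η ++ ζ ≡ ν

Incomparable : Seq → Seq → Set
Incomparable η ν = ¬ (η ⊴ ν) × ¬ (ν ⊴ η)

Seq≤2 : Set
Seq≤2 = Σ Seq (λ η → length η ≤ 2)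

-- Consistency (in the monster model, for small sets: realizability) of
-- { φ(x, b_i) : X i }
Consistent : (φ : Formula) {I : Set} → (I → Ys φ) → (I → Set) → Set
Consistent φ b X = ∃ λ c → ∀ i → X i → Sat φ c (b i)

Antichain : {I : Set} → (I → Seq) → (I → Set) → Set
Antichain e X = ∀ i j → X i → X j → e i ⊴ e j → e i ≡ e j

IsAntichainTree : (φ : Formula) {I : Set} → (I → Seq) → (I → Ys φ) → Set₁
IsAntichainTree φ {I} e b =
  (X : I → Set) → (Consistent φ b X → Antichain e X) × (Antichain e X → Consistent φ b X)

restrict : (ℕ → Bool) → ℕ → Seq
restrict f zero    = []
restrict f (suc n) = f 0 ∷ restrict (f ∘ suc) n

WitnessesSOP2 : (φ : Formula) → (Seq → Ys φ) → Set
WitnessesSOP2 φ a =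
  (∀ (η : ℕ → Bool) → Consistent φ a (λ ν → ∃ λ n → restrict η n ≡ ν))
  × (∀ η ν → Incomparable η ν → ¬ Consistent φ a (λ ρ → ρ ≡ η ⊎' ρ ≡ ν))
  where
    open import Data.Sum using () renaming (_⊎_ to _⊎'_)

SOP2Conditions≤2 : (φ : Formula) → (Seq≤2 → Ys φ) → Set
SOP2Conditions≤2 φ b =
  (∀ (η : Seq≤2) → length (proj₁ η) ≡ 2 → Consistent φ b (λ ν → proj₁ ν ⊴ proj₁ η))
  × (∀ (η ν : Seq≤2) → Incomparable (proj₁ η) (proj₁ ν)
       → ¬ Consistent φ b (λ ρ → ρ ≡ η ⊎' ρ ≡ ν))
  where
    open import Data.Sum using () renaming (_⊎_ to _⊎'_)

-- Both parts rest on the tree property of ω>2: a node comparable with both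
-- members of an incomparable pair lies below both of them. On pairs, an
-- antichain tree makes exactly the antichain pairs consistent, while an SOP₂
-- tree makes comparable pairs consistent and incomparable pairs inconsistent.
-- (i) An SOP₂ configuration inside an antichain tree sends incomparable nodes of
-- 2≥2 to distinct comparable nodes, and each node to a node equal or
-- incomparable to the images of its leaves. So above 0 and 1 there are leaves
-- l and m whose images are incomparable to h 0 and h 1 respectively; by the
-- tree property h l and h m lie below each other, hence coincide.
-- (ii) An antichain tree inside an SOP₂ tree sends incomparable nodes to
-- comparable ones and proper extensions to incomparable ones; by the tree
-- property h 0 ⊴ h 1 ⊴ h 00, although h 0 and h 00 are incomparable.
module Submission where

open import Defs
open import Data.Product using (Σ; _×_; proj₁)
open import Relation.Nullary using (¬_)
open import Function using (_∘_)

open import Data.Bool using (Bool; true; false)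
open import Data.Bool.Properties using () renaming (_≟_ to _≟ᵇ_)
open import Data.Empty using (⊥; ⊥-elim)
open import Data.List using ([]; _∷_; _++_; length)
open import Data.List.Properties using (++-assoc; ++-identityʳ)
open import Data.List.Relation.Binary.Pointwise using (Pointwise-≡⇒≡)
open import Data.List.Relation.Binary.Prefix.Heterogeneous using (Prefix; []; _∷_)
import Data.List.Relation.Binary.Prefix.Heterogeneous.Properties as Prefix
open import Data.Nat using (ℕ; zero; suc; z≤n; s≤s)
open import Data.Product using (∃; _,_; proj₂; map₂)
open import Data.Sum using (_⊎_; inj₁; inj₂; [_,_]′)
import Data.Sum as Sum
open import Function.Bundles using (_⇔_; mk⇔; Equivalence)
open import Relation.Nullary using (Dec; yes; no)
open import Relation.Nullary.Decidable using (map′)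
open import Relation.Binary.PropositionalEquality using (_≡_; _≢_; refl; sym; trans; cong)

open Equivalence using (to; from)

Comparable : Seq → Seq → Set
Comparable η ν = η ⊴ ν ⊎ ν ⊴ η

Pair : {I : Set} → I → I → I → Set
Pair i j ρ = ρ ≡ i ⊎ ρ ≡ j

⊴⇒Prefix : ∀ {η ν} → η ⊴ ν → Prefix _≡_ η ν
⊴⇒Prefix {[]}    _          = []
⊴⇒Prefix {b ∷ η} (ζ , refl) = refl ∷ ⊴⇒Prefix (ζ , refl)

Prefix⇒⊴ : ∀ {η ν} → Prefix _≡_ η ν → η ⊴ ν
Prefix⇒⊴ {ν = ν} []     = ν , refl
Prefix⇒⊴ (refl ∷ p)     = map₂ (cong (_ ∷_)) (Prefix⇒⊴ p)

⊴-refl : ∀ η → η ⊴ η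
⊴-refl η = [] , ++-identityʳ η

⊴-trans : ∀ {η ν ρ} → η ⊴ ν → ν ⊴ ρ → η ⊴ ρ
⊴-trans {η} (ζ , refl) (ξ , refl) = ζ ++ ξ , sym (++-assoc η ζ ξ)

⊴-antisym : ∀ {η ν} → η ⊴ ν → ν ⊴ η → η ≡ ν
⊴-antisym p q = Pointwise-≡⇒≡ (Prefix.antisym (λ e _ → e) (⊴⇒Prefix p) (⊴⇒Prefix q))

_⊴?_ : ∀ η ν → Dec (η ⊴ ν)
η ⊴? ν = map′ Prefix⇒⊴ ⊴⇒Prefix (Prefix.prefix? _≟ᵇ_ η ν)

¬incomparable⇒comparable : ∀ {η ν} → ¬ Incomparable η ν → Comparable η ν
¬incomparable⇒comparable {η} {ν} ¬inc with η ⊴? ν | ν ⊴? η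
... | yes p | _     = inj₁ p
... | no _  | yes q = inj₂ q
... | no p  | no q  = ⊥-elim (¬inc (p , q))

Prefix-common-extension⇒comparable : ∀ {η ν ρ : Seq} → Prefix _≡_ η ρ → Prefix _≡_ ν ρ
  → Prefix _≡_ η ν ⊎ Prefix _≡_ ν η
Prefix-common-extension⇒comparable []         _          = inj₁ []
Prefix-common-extension⇒comparable (_ ∷ _)    []         = inj₂ []
Prefix-common-extension⇒comparable (refl ∷ p) (refl ∷ q) =
  Sum.map (refl ∷_) (refl ∷_) (Prefix-common-extension⇒comparable p q)

common-extension⇒comparable : ∀ {η ν ρ} → η ⊴ ρ → ν ⊴ ρ → Comparable η ν
common-extension⇒comparable p q =
  Sum.map Prefix⇒⊴ Prefix⇒⊴ (Prefix-common-extension⇒comparable (⊴⇒Prefix p) (⊴⇒Prefix q))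

comparable-with-incomparable⇒⊴ : ∀ {ρ η ν} → Incomparable η ν
  → Comparable ρ η → Comparable ρ ν → ρ ⊴ ν
comparable-with-incomparable⇒⊴ _             _          (inj₁ ρ⊴ν) = ρ⊴ν
comparable-with-incomparable⇒⊴ (_ , ν⋬η)    (inj₁ ρ⊴η) (inj₂ ν⊴ρ) = ⊥-elim (ν⋬η (⊴-trans ν⊴ρ ρ⊴η))
comparable-with-incomparable⇒⊴ (η⋬ν , ν⋬η) (inj₂ η⊴ρ) (inj₂ ν⊴ρ) =
  ⊥-elim ([ η⋬ν , ν⋬η ]′ (common-extension⇒comparable η⊴ρ ν⊴ρ))

incomparable-sym : ∀ {η ν} → Incomparable η ν → Incomparable ν η
incomparable-sym (η⋬ν , ν⋬η) = ν⋬η , η⋬ν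

cross-comparable⇒≡ : ∀ {u v l m} → Incomparable u l → Incomparable v m
  → Comparable u m → Comparable v l → Comparable l m → l ≡ m
cross-comparable⇒≡ u∥l v∥m u~m v~l l~m = ⊴-antisym
  (comparable-with-incomparable⇒⊴ v∥m (Sum.swap v~l) l~m)
  (comparable-with-incomparable⇒⊴ u∥l (Sum.swap u~m) (Sum.swap l~m))

cross-comparable⇒⊥ : ∀ {u v l m} → Incomparable u l → Incomparable v m
  → Comparable u v → Comparable u m → Comparable v l → ⊥
cross-comparable⇒⊥ u∥l v∥m u~v u~m v~l = proj₁ u∥l (⊴-trans
  (comparable-with-incomparable⇒⊴ (incomparable-sym v∥m) u~m u~v)
  (comparable-with-incomparable⇒⊴ u∥l (Sum.swap u~v) v~l))

Antichain-pair⇔ : ∀ {I : Set} (e : I → Seq) {i j}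
  → Antichain e (Pair i j) ⇔ (e i ≡ e j ⊎ Incomparable (e i) (e j))
Antichain-pair⇔ e {i} {j} = mk⇔ equal-or-incomparable antichain
  where
  equal-or-incomparable : Antichain e (Pair i j) → e i ≡ e j ⊎ Incomparable (e i) (e j)
  equal-or-incomparable A with e i ⊴? e j | e j ⊴? e i
  ... | yes p | _     = inj₁ (A i j (inj₁ refl) (inj₂ refl) p)
  ... | no _  | yes q = inj₁ (sym (A j i (inj₂ refl) (inj₁ refl) q))
  ... | no p  | no q  = inj₂ (p , q)

  antichain : e i ≡ e j ⊎ Incomparable (e i) (e j) → Antichain e (Pair i j)
  antichain _                  _ _ (inj₁ refl) (inj₁ refl) _ = refl
  antichain _                  _ _ (inj₂ refl) (inj₂ refl) _ = refl
  antichain (inj₁ eq)          _ _ (inj₁ refl) (inj₂ refl) _ = eq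
  antichain (inj₁ eq)          _ _ (inj₂ refl) (inj₁ refl) _ = sym eq
  antichain (inj₂ (i⋬j , _))   _ _ (inj₁ refl) (inj₂ refl) p = ⊥-elim (i⋬j p)
  antichain (inj₂ (_ , j⋬i))   _ _ (inj₂ refl) (inj₁ refl) p = ⊥-elim (j⋬i p)

Consistent-mono : ∀ (φ : Formula) {I : Set} {b : I → Ys φ} {X Y : I → Set}
  → (∀ i → X i → Y i) → Consistent φ b Y → Consistent φ b X
Consistent-mono φ X⊆Y (c , sat) = c , λ i x → sat i (X⊆Y i x)

Consistent-pair-∘ : ∀ (φ : Formula) {I J : Set} (b : J → Ys φ) (h : I → J) {i j}
  → Consistent φ (b ∘ h) (Pair i j) ⇔ Consistent φ b (Pair (h i) (h j))
Consistent-pair-∘ φ b h {i} {j} = mk⇔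
  (λ (c , sat) → c , λ { _ (inj₁ refl) → sat i (inj₁ refl) ; _ (inj₂ refl) → sat j (inj₂ refl) })
  (λ (c , sat) → c , λ { _ (inj₁ refl) → sat (h i) (inj₁ refl) ; _ (inj₂ refl) → sat (h j) (inj₂ refl) })

Consistent-pair-swap : ∀ (φ : Formula) {I : Set} {b : I → Ys φ} {i j}
  → Consistent φ b (Pair i j) → Consistent φ b (Pair j i)
Consistent-pair-swap φ = Consistent-mono φ (λ _ → Sum.swap)

module _ (φ : Formula) {I : Set} {e : I → Seq} {b : I → Ys φ}
         (tree : IsAntichainTree φ e b) {i j : I} where

  antichainTree-consistent⇒equal-or-incomparable : Consistent φ b (Pair i j)
    → e i ≡ e j ⊎ Incomparable (e i) (e j)
  antichainTree-consistent⇒equal-or-incomparable =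
    to (Antichain-pair⇔ e) ∘ proj₁ (tree (Pair i j))

  antichainTree-equal-or-incomparable⇒consistent : e i ≡ e j ⊎ Incomparable (e i) (e j)
    → Consistent φ b (Pair i j)
  antichainTree-equal-or-incomparable⇒consistent =
    proj₂ (tree (Pair i j)) ∘ from (Antichain-pair⇔ e)

  antichainTree-inconsistent⇒distinct-comparable : ¬ Consistent φ b (Pair i j)
    → e i ≢ e j × Comparable (e i) (e j)
  antichainTree-inconsistent⇒distinct-comparable ¬con =
      (¬con ∘ antichainTree-equal-or-incomparable⇒consistent ∘ inj₁)
    , ¬incomparable⇒comparable (¬con ∘ antichainTree-equal-or-incomparable⇒consistent ∘ inj₂)

extend : Seq → ℕ → Bool
extend []      _       = false
extend (b ∷ η) zero    = b
extend (b ∷ η) (suc n) = extend η n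

restrict-extend : ∀ {η ν} → η ⊴ ν → restrict (extend ν) (length η) ≡ η
restrict-extend {[]}    _          = refl
restrict-extend {b ∷ η} (ζ , refl) = cong (b ∷_) (restrict-extend (ζ , refl))

WitnessesSOP2-⊴⇒consistent : ∀ (φ : Formula) {a : Seq → Ys φ} → WitnessesSOP2 φ a
  → ∀ {η ν} → η ⊴ ν → Consistent φ a (Pair η ν)
WitnessesSOP2-⊴⇒consistent φ sop {η} {ν} η⊴ν = Consistent-mono φ on-branch (proj₁ sop (extend ν))
  where
  on-branch : ∀ ρ → Pair η ν ρ → ∃ λ n → restrict (extend ν) n ≡ ρ
  on-branch _ (inj₁ refl) = length η , restrict-extend η⊴ν
  on-branch _ (inj₂ refl) = length ν , restrict-extend (⊴-refl ν)

WitnessesSOP2-comparable⇒consistent : ∀ (φ : Formula) {a : Seq → Ys φ} → WitnessesSOP2 φ a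
  → ∀ {η ν} → Comparable η ν → Consistent φ a (Pair η ν)
WitnessesSOP2-comparable⇒consistent φ sop (inj₁ η⊴ν) = WitnessesSOP2-⊴⇒consistent φ sop η⊴ν
WitnessesSOP2-comparable⇒consistent φ sop (inj₂ ν⊴η) =
  Consistent-pair-swap φ (WitnessesSOP2-⊴⇒consistent φ sop ν⊴η)

node : Bool → Seq≤2
node b = b ∷ [] , s≤s z≤n

leaf : Bool → Bool → Seq≤2
leaf b c = b ∷ c ∷ [] , s≤s (s≤s z≤n)

halves-incomparable : ∀ {η ν} → Incomparable (false ∷ η) (true ∷ ν)
halves-incomparable = (λ { (_ , ()) }) , (λ { (_ , ()) })

sibling-leaves-incomparable : ∀ b → Incomparable (proj₁ (leaf b false)) (proj₁ (leaf b true))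
sibling-leaves-incomparable b = (λ { (_ , ()) }) , (λ { (_ , ()) })

node⊴leaf : ∀ b c → proj₁ (node b) ⊴ proj₁ (leaf b c)
node⊴leaf b c = c ∷ [] , refl

node≢leaf : ∀ b c → proj₁ (node b) ≢ proj₁ (leaf b c)
node≢leaf b c ()

module _ (φ : Formula) (a : Seq → Ys φ) (tree : IsAntichainTree φ (λ η → η) a) where

  antichainTree⇒¬SOP2-embedding : ¬ Σ (Seq≤2 → Seq) (λ h → SOP2Conditions≤2 φ (a ∘ h))
  antichainTree⇒¬SOP2-embedding (h , branch , inconsistent) =
    let i , u∥l = incomparable-leaf false
        j , v∥m = incomparable-leaf true
    in proj₁ (images-distinct-comparable (leaf false i) (leaf true j) halves-incomparable)
         (cross-comparable⇒≡ u∥l v∥m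
           (images-comparable (node false) (leaf true j) halves-incomparable)
           (images-comparable (node true) (leaf false i) (incomparable-sym halves-incomparable))
           (images-comparable (leaf false i) (leaf true j) halves-incomparable))
    where
    images-distinct-comparable : ∀ η ν → Incomparable (proj₁ η) (proj₁ ν)
      → h η ≢ h ν × Comparable (h η) (h ν)
    images-distinct-comparable η ν η∥ν = antichainTree-inconsistent⇒distinct-comparable φ tree
      (inconsistent η ν η∥ν ∘ from (Consistent-pair-∘ φ a h))

    images-comparable : ∀ η ν → Incomparable (proj₁ η) (proj₁ ν) → Comparable (h η) (h ν)
    images-comparable η ν = proj₂ ∘ images-distinct-comparable η ν

    images-on-branch : ∀ b c
      → h (node b) ≡ h (leaf b c) ⊎ Incomparable (h (node b)) (h (leaf b c))
    images-on-branch b c = antichainTree-consistent⇒equal-or-incomparable φ tree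
      (to (Consistent-pair-∘ φ a h)
        (Consistent-mono φ (λ { _ (inj₁ refl) → node⊴leaf b c ; _ (inj₂ refl) → ⊴-refl _ })
          (branch (leaf b c) refl)))

    -- The two leaves above a node have distinct images, so not both equal its image.
    incomparable-leaf : ∀ b → ∃ λ c → Incomparable (h (node b)) (h (leaf b c))
    incomparable-leaf b with images-on-branch b false | images-on-branch b true
    ... | inj₂ ∥ | _      = false , ∥
    ... | inj₁ _ | inj₂ ∥ = true , ∥
    ... | inj₁ e | inj₁ e′ =
      ⊥-elim (proj₁ (images-distinct-comparable (leaf b false) (leaf b true)
                                                (sibling-leaves-incomparable b))
                    (trans (sym e) e′))

module _ (φ : Formula) (a : Seq → Ys φ) (sop : WitnessesSOP2 φ a) where

  SOP2⇒¬antichainTree-embedding : ¬ Σ (Seq≤2 → Seq) (λ h → IsAntichainTree φ proj₁ (a ∘ h))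
  SOP2⇒¬antichainTree-embedding (h , tree) =
    cross-comparable⇒⊥ (images-incomparable false false) (images-incomparable true false)
      (images-comparable (node false) (node true) halves-incomparable)
      (images-comparable (node false) (leaf true false) halves-incomparable)
      (images-comparable (node true) (leaf false false) (incomparable-sym halves-incomparable))
    where
    images-comparable : ∀ η ν → Incomparable (proj₁ η) (proj₁ ν) → Comparable (h η) (h ν)
    images-comparable η ν η∥ν = ¬incomparable⇒comparable λ hη∥hν →
      proj₂ sop (h η) (h ν) hη∥hν
        (to (Consistent-pair-∘ φ a h)
          (antichainTree-equal-or-incomparable⇒consistent φ tree (inj₂ η∥ν)))

    images-incomparable : ∀ b c → Incomparable (h (node b)) (h (leaf b c))
    images-incomparable b c = ¬comparable ∘ inj₁ , ¬comparable ∘ inj₂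
      where
      ¬consistent : ¬ Consistent φ (a ∘ h) (Pair (node b) (leaf b c))
      ¬consistent con with antichainTree-consistent⇒equal-or-incomparable φ tree con
      ... | inj₁ eq       = node≢leaf b c eq
      ... | inj₂ (⋬ , _)  = ⋬ (node⊴leaf b c)

      ¬comparable : ¬ Comparable (h (node b)) (h (leaf b c))
      ¬comparable = ¬consistent ∘ from (Consistent-pair-∘ φ a h)
                  ∘ WitnessesSOP2-comparable⇒consistent φ sop

mainTheorem11 : (φ : Formula) (a : Seq → Ys φ)
    → (IsAntichainTree φ (λ η → η) a
         → ¬ (Σ (Seq≤2 → Seq) (λ h → SOP2Conditions≤2 φ (a ∘ h))))
    × (WitnessesSOP2 φ a
         → ¬ (Σ (Seq≤2 → Seq) (λ h → IsAntichainTree φ proj₁ (a ∘ h))))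
mainTheorem11 φ a = antichainTree⇒¬SOP2-embedding φ a , SOP2⇒¬antichainTree-embedding φ a
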